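{- Let $G=K_{n,m}$ be a complete bipartite graph with $n\ge m\ge k\ge 1$. Then $$\gamma_{\times k,t}^{r}(G)=\begin{cases} 2k & \text{if } n\ge m\ge 2k,\\ n+m & \text{otherwise.}\end{cases}$$
   Context: All graphs are finite and simple; $N(x)$ denotes the open neighborhood of $x$. For an integer $k\ge 1$, a set $S\subseteq V(G)$ is a $k$-tuple total dominating set of $G$ if $|N(x)\cap S|\ge k$ for every $x\in V(G)$. It is a $k$-tuple total restrained dominating set (kTRDS) if moreover every vertex $x\in V(G)\setminus S$ is adjacent to at least $k$ vertices of $V(G)\setminus S$. For a graph with minimum degree at least $k$, $\gamma_{\times k,t}^{r}(G)$ denotes the minimum cardinality of a kTRDS of $G$. $K_{n,m}$ is the complete bipartite graph with parts of sizes $n$ and $m$. -}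

module Defs where

open import Data.Nat using (ℕ; _+_; _*_; _≤_; _≥_)
open import Data.Bool using (Bool; true; false; _xor_; not)
open import Data.Fin using (Fin; toℕ; _<?_)
open import Data.Fin.Subset using (Subset; _∈_; _∉_; _∩_; ∁; ∣_∣)
open import Data.Vec using (tabulate)
open import Data.Product using (Σ; _×_; _,_)
open import Relation.Binary.PropositionalEquality using (_≡_)
open import Relation.Nullary.Decidable using (⌊_⌋)

record Graph (v : ℕ) : Set where
  field
    adj   : Fin v → Fin v → Bool
    sym   : ∀ x y → adj x y ≡ adj y x
    irrefl : ∀ x → adj x x ≡ false

open Graph public

N : ∀ {v} → Graph v → Fin v → Subset v
N G x = tabulate (adj G x)

MinDeg≥ : ∀ {v} → Graph v → ℕ → Set
MinDeg≥ G k = ∀ x → ∣ N G x ∣ ≥ k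

IsKTRDS : ∀ {v} → Graph v → ℕ → Subset v → Set
IsKTRDS G k S =
  (∀ x → ∣ N G x ∩ S ∣ ≥ k) ×
  (∀ x → x ∉ S → ∣ N G x ∩ ∁ S ∣ ≥ k)

IsKTRDNumber : ∀ {v} → Graph v → ℕ → ℕ → Set
IsKTRDNumber G k γ =
  Σ (Subset _) (λ S → IsKTRDS G k S × ∣ S ∣ ≡ γ) ×
  (∀ S → IsKTRDS G k S → γ ≤ ∣ S ∣)

-- complete bipartite graph K_{n,m} on Fin (n + m):
-- vertices with index < n form the first part (size n), the rest the second (size m)
side : ∀ {n m} → Fin (n + m) → Bool
side {n} x = ⌊ toℕ x Data.Nat.<? n ⌋

K : (n m : ℕ) → Graph (n + m)
K n m = record { adj = λ x y → side {n} {m} x xor side {n} {m} y ; sym = s ; irrefl = i }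
  where
  s : ∀ x y → (side {n} {m} x xor side {n} {m} y) ≡ (side {n} {m} y xor side {n} {m} x)
  s x y with side {n} {m} x | side {n} {m} y
  ... | true | true = Relation.Binary.PropositionalEquality.refl
  ... | true | false = Relation.Binary.PropositionalEquality.refl
  ... | false | true = Relation.Binary.PropositionalEquality.refl
  ... | false | false = Relation.Binary.PropositionalEquality.refl
  i : ∀ x → (side {n} {m} x xor side {n} {m} x) ≡ false
  i x with side {n} {m} x
  ... | true = Relation.Binary.PropositionalEquality.refl
  ... | false = Relation.Binary.PropositionalEquality.refl

-- In K_{n,m} write S = p ++ q with p on the side of size n and q on the side of size m.
-- Every vertex of one side is adjacent to exactly the other side, so S is a kTRDS iff
-- |p| ≥ k, |q| ≥ k, m − |q| ≥ k unless p is the whole first side, and n − |p| ≥ k unless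
-- q is the whole second side.  Hence |S| ≥ 2k, attained by k vertices on each side when
-- 2k ≤ m ≤ n.  If m < 2k the first side lies in S (else 2k ≤ |q| + (m − |q|) = m), so
-- n − |p| = 0 < k forces the second side into S as well.
module Submission where

open import Defs hiding (sym)
open import Data.Nat using (ℕ; zero; suc; _+_; _*_; _∸_; _≤_; _<_; _<?_; z≤n; s≤s)
open import Data.Nat.Properties
  using (≤-trans; ≤-reflexive; +-identityʳ; +-mono-≤; +-monoʳ-≤; m≤m+n; ∸-monoʳ-≤; n∸n≡0; <⇒≱;
         m+n≤o⇒m≤o∸n; m≤o∸n⇒m+n≤o; module ≤-Reasoning)
open import Data.Bool using (true; false; _xor_)
open import Data.Fin using (Fin; zero; suc; toℕ; fromℕ<; _↑ˡ_; _↑ʳ_; splitAt; join)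
open import Data.Fin.Properties using (toℕ-↑ˡ; toℕ-↑ʳ; toℕ<n; join-splitAt)
open import Data.Fin.Subset using (Subset; _∈_; _∉_; _∩_; ∁; ∣_∣; ⊤; ⊥)
open import Data.Fin.Subset.Properties
  using (_∈?_; ∈⊤; ∣⊤∣≡n; ∣⊥∣≡0; ∣∁p∣≡n∸∣p∣; ∣p∣≤n; ∩-identityˡ; ∩-zeroˡ; p⊆q⇒∣p∣≤∣q∣)
open import Data.Vec using ([]; _∷_; _++_; here; there; tabulate)
import Data.Vec as Vec
open import Data.Vec.Properties using (tabulate-cong; map-++)
open import Data.Sum using ([_,_])
open import Data.Product using (Σ; _×_; _,_)
open import Function using (_∘_; _⇔_; mk⇔; Equivalence)
open import Relation.Nullary using (¬_; contradiction)
open import Relation.Nullary.Decidable using (dec-true; dec-false; isYes≗does; decidable-stable)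
open import Relation.Binary.PropositionalEquality
  using (_≡_; refl; sym; trans; cong; cong₂; subst; module ≡-Reasoning)

private
  variable
    n m : ℕ

↑ˡ↑ʳ-elim : (P : Fin (n + m) → Set) →
            (∀ i → P (i ↑ˡ m)) → (∀ j → P (n ↑ʳ j)) → ∀ x → P x
↑ˡ↑ʳ-elim {n} {m} P left right x =
  subst P (join-splitAt n m x) ([_,_] {C = P ∘ join n m} left right (splitAt n x))

++-elim : (P : Subset (n + m) → Set) → (∀ p q → P (p ++ q)) → ∀ s → P s
++-elim {n} P h s with Vec.splitAt n s
... | p , q , refl = h p q

tabulate-++ : ∀ {A : Set} n (f : Fin (n + m) → A) →
              tabulate f ≡ tabulate (f ∘ (_↑ˡ m)) ++ tabulate (f ∘ (n ↑ʳ_))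
tabulate-++ zero    f = refl
tabulate-++ (suc n) f = cong (f zero ∷_) (tabulate-++ n (f ∘ suc))

tabulate-false≡⊥ : tabulate (λ (_ : Fin n) → false) ≡ ⊥
tabulate-false≡⊥ {zero}  = refl
tabulate-false≡⊥ {suc n} = cong (false ∷_) tabulate-false≡⊥

tabulate-true≡⊤ : tabulate (λ (_ : Fin n) → true) ≡ ⊤
tabulate-true≡⊤ {zero}  = refl
tabulate-true≡⊤ {suc n} = cong (true ∷_) tabulate-true≡⊤

∩-++ : (p r : Subset n) (q s : Subset m) → (p ++ q) ∩ (r ++ s) ≡ (p ∩ r) ++ (q ∩ s)
∩-++ []      []      q s = refl
∩-++ (x ∷ p) (y ∷ r) q s = cong (_ ∷_) (∩-++ p r q s)

∁-++ : (p : Subset n) (q : Subset m) → ∁ (p ++ q) ≡ ∁ p ++ ∁ q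
∁-++ = map-++ _

∣p++q∣≡∣p∣+∣q∣ : (p : Subset n) (q : Subset m) → ∣ p ++ q ∣ ≡ ∣ p ∣ + ∣ q ∣
∣p++q∣≡∣p∣+∣q∣ []          q = refl
∣p++q∣≡∣p∣+∣q∣ (false ∷ p) q = ∣p++q∣≡∣p∣+∣q∣ p q
∣p++q∣≡∣p∣+∣q∣ (true  ∷ p) q = cong suc (∣p++q∣≡∣p∣+∣q∣ p q)

↑ˡ-∈-++⁺ : {i : Fin n} {p : Subset n} {q : Subset m} → i ∈ p → i ↑ˡ m ∈ p ++ q
↑ˡ-∈-++⁺ here        = here
↑ˡ-∈-++⁺ (there i∈p) = there (↑ˡ-∈-++⁺ i∈p)

↑ˡ-∈-++⁻ : (i : Fin n) (p : Subset n) {q : Subset m} → i ↑ˡ m ∈ p ++ q → i ∈ p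
↑ˡ-∈-++⁻ zero    (_ ∷ p) here       = here
↑ˡ-∈-++⁻ (suc i) (_ ∷ p) (there x∈) = there (↑ˡ-∈-++⁻ i p x∈)

↑ʳ-∈-++⁺ : (p : Subset n) {q : Subset m} {j : Fin m} → j ∈ q → n ↑ʳ j ∈ p ++ q
↑ʳ-∈-++⁺ []      j∈q = j∈q
↑ʳ-∈-++⁺ (_ ∷ p) j∈q = there (↑ʳ-∈-++⁺ p j∈q)

↑ʳ-∈-++⁻ : (p : Subset n) {q : Subset m} {j : Fin m} → n ↑ʳ j ∈ p ++ q → j ∈ q
↑ʳ-∈-++⁻ []      x∈        = x∈
↑ʳ-∈-++⁻ (_ ∷ p) (there x∈) = ↑ʳ-∈-++⁻ p x∈

∀¬∉⇒n≤∣p∣ : (p : Subset n) → (∀ i → ¬ i ∉ p) → n ≤ ∣ p ∣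
∀¬∉⇒n≤∣p∣ {n} p ¬∉ = subst (_≤ ∣ p ∣) (∣⊤∣≡n n)
  (p⊆q⇒∣p∣≤∣q∣ {p = ⊤} (λ {i} _ → decidable-stable (i ∈? p) (¬∉ i)))

initial : ℕ → (a : ℕ) → Subset a
initial k       zero    = []
initial zero    (suc a) = false ∷ initial zero a
initial (suc k) (suc a) = true ∷ initial k a

∣initial∣ : ∀ k {a} → k ≤ a → ∣ initial k a ∣ ≡ k
∣initial∣ zero    {zero}  _         = refl
∣initial∣ zero    {suc a} _         = ∣initial∣ zero {a} z≤n
∣initial∣ (suc k) {suc a} (s≤s k≤a) = cong suc (∣initial∣ k k≤a)

∣⊥++⊤∩p++q∣ : (p : Subset n) (q : Subset m) → ∣ (⊥ {n} ++ ⊤ {m}) ∩ (p ++ q) ∣ ≡ ∣ q ∣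
∣⊥++⊤∩p++q∣ {n} {m} p q = begin
  ∣ (⊥ {n} ++ ⊤ {m}) ∩ (p ++ q) ∣ ≡⟨ cong ∣_∣ (∩-++ ⊥ p ⊤ q) ⟩
  ∣ (⊥ ∩ p) ++ (⊤ ∩ q) ∣          ≡⟨ ∣p++q∣≡∣p∣+∣q∣ (⊥ ∩ p) (⊤ ∩ q) ⟩
  ∣ ⊥ ∩ p ∣ + ∣ ⊤ ∩ q ∣           ≡⟨ cong₂ _+_ (cong ∣_∣ (∩-zeroˡ p)) (cong ∣_∣ (∩-identityˡ q)) ⟩
  ∣ ⊥ {n} ∣ + ∣ q ∣               ≡⟨ cong (_+ ∣ q ∣) (∣⊥∣≡0 n) ⟩
  ∣ q ∣                           ∎
  where open ≡-Reasoning

∣⊤++⊥∩p++q∣ : (p : Subset n) (q : Subset m) → ∣ (⊤ {n} ++ ⊥ {m}) ∩ (p ++ q) ∣ ≡ ∣ p ∣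
∣⊤++⊥∩p++q∣ {n} {m} p q = begin
  ∣ (⊤ {n} ++ ⊥ {m}) ∩ (p ++ q) ∣ ≡⟨ cong ∣_∣ (∩-++ ⊤ p ⊥ q) ⟩
  ∣ (⊤ ∩ p) ++ (⊥ ∩ q) ∣          ≡⟨ ∣p++q∣≡∣p∣+∣q∣ (⊤ ∩ p) (⊥ ∩ q) ⟩
  ∣ ⊤ ∩ p ∣ + ∣ ⊥ ∩ q ∣           ≡⟨ cong₂ _+_ (cong ∣_∣ (∩-identityˡ p)) (cong ∣_∣ (∩-zeroˡ q)) ⟩
  ∣ p ∣ + ∣ ⊥ {m} ∣               ≡⟨ cong (∣ p ∣ +_) (∣⊥∣≡0 m) ⟩
  ∣ p ∣ + 0                       ≡⟨ +-identityʳ ∣ p ∣ ⟩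
  ∣ p ∣                           ∎
  where open ≡-Reasoning

module _ {n m : ℕ} where

  side-↑ˡ : (i : Fin n) → side {n} {m} (i ↑ˡ m) ≡ true
  side-↑ˡ i = trans (isYes≗does (toℕ (i ↑ˡ m) <? n))
    (dec-true (toℕ (i ↑ˡ m) <? n) (subst (_< n) (sym (toℕ-↑ˡ i m)) (toℕ<n i)))

  side-↑ʳ : (j : Fin m) → side {n} {m} (n ↑ʳ j) ≡ false
  side-↑ʳ j = trans (isYes≗does (toℕ (n ↑ʳ j) <? n))
    (dec-false (toℕ (n ↑ʳ j) <? n)
      (λ j< → <⇒≱ j< (subst (n ≤_) (sym (toℕ-↑ʳ n j)) (m≤m+n n (toℕ j)))))

  N-K-↑ˡ : (i : Fin n) → N (K n m) (i ↑ˡ m) ≡ ⊥ {n} ++ ⊤ {m}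
  N-K-↑ˡ i = trans (tabulate-++ n _) (cong₂ (_++_ {m = n})
    (trans (tabulate-cong λ i′ → cong₂ _xor_ (side-↑ˡ i) (side-↑ˡ i′)) tabulate-false≡⊥)
    (trans (tabulate-cong λ j → cong₂ _xor_ (side-↑ˡ i) (side-↑ʳ j)) tabulate-true≡⊤))

  N-K-↑ʳ : (j : Fin m) → N (K n m) (n ↑ʳ j) ≡ ⊤ {n} ++ ⊥ {m}
  N-K-↑ʳ j = trans (tabulate-++ n _) (cong₂ (_++_ {m = n})
    (trans (tabulate-cong λ i → cong₂ _xor_ (side-↑ʳ j) (side-↑ˡ i)) tabulate-true≡⊤)
    (trans (tabulate-cong λ j′ → cong₂ _xor_ (side-↑ʳ j) (side-↑ʳ j′)) tabulate-false≡⊥))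

∣N-K-↑ˡ∩∣ : (i : Fin n) (p : Subset n) (q : Subset m) → ∣ N (K n m) (i ↑ˡ m) ∩ (p ++ q) ∣ ≡ ∣ q ∣
∣N-K-↑ˡ∩∣ i p q = trans (cong (λ v → ∣ v ∩ (p ++ q) ∣) (N-K-↑ˡ i)) (∣⊥++⊤∩p++q∣ p q)

∣N-K-↑ʳ∩∣ : (j : Fin m) (p : Subset n) (q : Subset m) → ∣ N (K n m) (n ↑ʳ j) ∩ (p ++ q) ∣ ≡ ∣ p ∣
∣N-K-↑ʳ∩∣ j p q = trans (cong (λ v → ∣ v ∩ (p ++ q) ∣) (N-K-↑ʳ j)) (∣⊤++⊥∩p++q∣ p q)

∣N-K-↑ˡ∩∁∣ : (i : Fin n) (p : Subset n) (q : Subset m) →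
             ∣ N (K n m) (i ↑ˡ m) ∩ ∁ (p ++ q) ∣ ≡ m ∸ ∣ q ∣
∣N-K-↑ˡ∩∁∣ {n} {m} i p q = begin
  ∣ N (K n m) (i ↑ˡ m) ∩ ∁ (p ++ q) ∣   ≡⟨ cong (λ v → ∣ N (K n m) (i ↑ˡ m) ∩ v ∣) (∁-++ p q) ⟩
  ∣ N (K n m) (i ↑ˡ m) ∩ (∁ p ++ ∁ q) ∣ ≡⟨ ∣N-K-↑ˡ∩∣ i (∁ p) (∁ q) ⟩
  ∣ ∁ q ∣                              ≡⟨ ∣∁p∣≡n∸∣p∣ q ⟩
  m ∸ ∣ q ∣                            ∎
  where open ≡-Reasoning

∣N-K-↑ʳ∩∁∣ : {n m : ℕ} (j : Fin m) (p : Subset n) (q : Subset m) →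
             ∣ N (K n m) (n ↑ʳ j) ∩ ∁ (p ++ q) ∣ ≡ n ∸ ∣ p ∣
∣N-K-↑ʳ∩∁∣ {n} {m} j p q = begin
  ∣ N (K n m) (n ↑ʳ j) ∩ ∁ (p ++ q) ∣   ≡⟨ cong (λ v → ∣ N (K n m) (n ↑ʳ j) ∩ v ∣) (∁-++ p q) ⟩
  ∣ N (K n m) (n ↑ʳ j) ∩ (∁ p ++ ∁ q) ∣ ≡⟨ ∣N-K-↑ʳ∩∣ j (∁ p) (∁ q) ⟩
  ∣ ∁ p ∣                              ≡⟨ ∣∁p∣≡n∸∣p∣ p ⟩
  n ∸ ∣ p ∣                            ∎
  where open ≡-Reasoning

-- The two conditions of IsKTRDS (K n m) k (p ++ q), read off at a vertex of the first side
-- (…-left), which sees exactly q, and of the second side (…-right), which sees exactly p.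
record BipartiteKTRDS (k : ℕ) (p : Subset n) (q : Subset m) : Set where
  field
    dominate-left   : Fin n → k ≤ ∣ q ∣
    dominate-right  : Fin m → k ≤ ∣ p ∣
    restrain-left   : ∀ i → i ∉ p → k ≤ m ∸ ∣ q ∣
    restrain-right  : ∀ j → j ∉ q → k ≤ n ∸ ∣ p ∣

K-isKTRDS⇔ : ∀ k (p : Subset n) (q : Subset m) →
             IsKTRDS (K n m) k (p ++ q) ⇔ BipartiteKTRDS k p q
K-isKTRDS⇔ {n} {m} k p q = mk⇔ to from
  where
  open BipartiteKTRDS

  to : IsKTRDS (K n m) k (p ++ q) → BipartiteKTRDS k p q
  to (dominated , restrained) = record
    { dominate-left  = λ i → subst (k ≤_) (∣N-K-↑ˡ∩∣ i p q) (dominated (i ↑ˡ m))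
    ; dominate-right = λ j → subst (k ≤_) (∣N-K-↑ʳ∩∣ j p q) (dominated (n ↑ʳ j))
    ; restrain-left  = λ i i∉p →
        subst (k ≤_) (∣N-K-↑ˡ∩∁∣ i p q) (restrained (i ↑ˡ m) (i∉p ∘ ↑ˡ-∈-++⁻ i p))
    ; restrain-right = λ j j∉q →
        subst (k ≤_) (∣N-K-↑ʳ∩∁∣ j p q) (restrained (n ↑ʳ j) (j∉q ∘ ↑ʳ-∈-++⁻ p))
    }

  from : BipartiteKTRDS k p q → IsKTRDS (K n m) k (p ++ q)
  from c = dominated , restrained
    where
    dominated : ∀ x → k ≤ ∣ N (K n m) x ∩ (p ++ q) ∣
    dominated = ↑ˡ↑ʳ-elim _
      (λ i → subst (k ≤_) (sym (∣N-K-↑ˡ∩∣ i p q)) (dominate-left c i))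
      (λ j → subst (k ≤_) (sym (∣N-K-↑ʳ∩∣ j p q)) (dominate-right c j))

    restrained : ∀ x → x ∉ p ++ q → k ≤ ∣ N (K n m) x ∩ ∁ (p ++ q) ∣
    restrained = ↑ˡ↑ʳ-elim _
      (λ i x∉ → subst (k ≤_) (sym (∣N-K-↑ˡ∩∁∣ i p q)) (restrain-left c i (x∉ ∘ ↑ˡ-∈-++⁺)))
      (λ j x∉ → subst (k ≤_) (sym (∣N-K-↑ʳ∩∁∣ j p q)) (restrain-right c j (x∉ ∘ ↑ʳ-∈-++⁺ p)))

2*k≡k+k : ∀ k → 2 * k ≡ k + k
2*k≡k+k k = cong (k +_) (+-identityʳ k)

K-kTRDS-size≥2k : ∀ k → Fin n → Fin m →
                  (S : Subset (n + m)) → IsKTRDS (K n m) k S → 2 * k ≤ ∣ S ∣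
K-kTRDS-size≥2k {n} {m} k i j = ++-elim {n} {m} _ λ p q S-kTRDS →
  let open BipartiteKTRDS (Equivalence.to (K-isKTRDS⇔ k p q) S-kTRDS) in begin
    2 * k         ≡⟨ 2*k≡k+k k ⟩
    k + k         ≤⟨ +-mono-≤ (dominate-right j) (dominate-left i) ⟩
    ∣ p ∣ + ∣ q ∣ ≡⟨ ∣p++q∣≡∣p∣+∣q∣ p q ⟨
    ∣ p ++ q ∣    ∎
  where open ≤-Reasoning

K-kTRDS-size≥n+m : ∀ {n m} k → 1 ≤ k → m < 2 * k →
                   (S : Subset (n + m)) → IsKTRDS (K n m) k S → n + m ≤ ∣ S ∣
K-kTRDS-size≥n+m {n} {m} k 1≤k m<2k = ++-elim {n} {m} _ λ p q S-kTRDS →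
  full p q (Equivalence.to (K-isKTRDS⇔ k p q) S-kTRDS)
  where
  full : (p : Subset n) (q : Subset m) → BipartiteKTRDS k p q → n + m ≤ ∣ p ++ q ∣
  full p q c = subst (n + m ≤_) (sym (∣p++q∣≡∣p∣+∣q∣ p q)) (+-mono-≤ n≤∣p∣ m≤∣q∣)
    where
    open BipartiteKTRDS c
    n≤∣p∣ : n ≤ ∣ p ∣
    n≤∣p∣ = ∀¬∉⇒n≤∣p∣ p λ i i∉p → <⇒≱ m<2k (subst (_≤ m) (sym (2*k≡k+k k))
      (≤-trans (+-monoʳ-≤ k (dominate-left i)) (m≤o∸n⇒m+n≤o k (∣p∣≤n q) (restrain-left i i∉p))))
    m≤∣q∣ : m ≤ ∣ q ∣
    m≤∣q∣ = ∀¬∉⇒n≤∣p∣ q λ j j∉q → <⇒≱ 1≤k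
      (≤-trans (restrain-right j j∉q) (≤-trans (∸-monoʳ-≤ n n≤∣p∣) (≤-reflexive (n∸n≡0 n))))

K-has-kTRDS-of-size-2k : ∀ k → 2 * k ≤ n → 2 * k ≤ m →
                         Σ (Subset (n + m)) λ S → IsKTRDS (K n m) k S × ∣ S ∣ ≡ 2 * k
K-has-kTRDS-of-size-2k {n} {m} k 2k≤n 2k≤m =
  initial k n ++ initial k m , Equivalence.from (K-isKTRDS⇔ k _ _) conditions , size
  where
  k≤ : ∀ {a} → 2 * k ≤ a → k ≤ a
  k≤ = ≤-trans (m≤m+n k _)
  k≤∸ : ∀ {a} → 2 * k ≤ a → k ≤ a ∸ ∣ initial k a ∣
  k≤∸ {a} 2k≤a = subst (λ c → k ≤ a ∸ c) (sym (∣initial∣ k (k≤ 2k≤a)))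
    (m+n≤o⇒m≤o∸n k (subst (_≤ a) (2*k≡k+k k) 2k≤a))
  conditions : BipartiteKTRDS k (initial k n) (initial k m)
  conditions = record
    { dominate-left  = λ _ → ≤-reflexive (sym (∣initial∣ k (k≤ 2k≤m)))
    ; dominate-right = λ _ → ≤-reflexive (sym (∣initial∣ k (k≤ 2k≤n)))
    ; restrain-left  = λ _ _ → k≤∸ 2k≤m
    ; restrain-right = λ _ _ → k≤∸ 2k≤n
    }
  size : ∣ initial k n ++ initial k m ∣ ≡ 2 * k
  size = begin
    ∣ initial k n ++ initial k m ∣       ≡⟨ ∣p++q∣≡∣p∣+∣q∣ (initial k n) (initial k m) ⟩
    ∣ initial k n ∣ + ∣ initial k m ∣    ≡⟨ cong₂ _+_ (∣initial∣ k (k≤ 2k≤n)) (∣initial∣ k (k≤ 2k≤m)) ⟩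
    k + k                                ≡⟨ 2*k≡k+k k ⟨
    2 * k                                ∎
    where open ≡-Reasoning

K-has-kTRDS-of-size-n+m : ∀ k → k ≤ n → k ≤ m →
                          Σ (Subset (n + m)) λ S → IsKTRDS (K n m) k S × ∣ S ∣ ≡ n + m
K-has-kTRDS-of-size-n+m {n} {m} k k≤n k≤m =
  ⊤ {n} ++ ⊤ {m} , Equivalence.from (K-isKTRDS⇔ k ⊤ ⊤) conditions ,
  trans (∣p++q∣≡∣p∣+∣q∣ (⊤ {n}) (⊤ {m})) (cong₂ _+_ (∣⊤∣≡n n) (∣⊤∣≡n m))
  where
  conditions : BipartiteKTRDS k (⊤ {n}) (⊤ {m})
  conditions = record
    { dominate-left  = λ _ → subst (k ≤_) (sym (∣⊤∣≡n m)) k≤m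
    ; dominate-right = λ _ → subst (k ≤_) (sym (∣⊤∣≡n n)) k≤n
    ; restrain-left  = λ _ i∉⊤ → contradiction ∈⊤ i∉⊤
    ; restrain-right = λ _ j∉⊤ → contradiction ∈⊤ j∉⊤
    }

corollary2p6 : (n m k : ℕ) → 1 ≤ k → k ≤ m → m ≤ n →
    ((2 * k ≤ m) → IsKTRDNumber (K n m) k (2 * k)) ×
    ((m < 2 * k) → IsKTRDNumber (K n m) k (n + m))
corollary2p6 n m k 1≤k k≤m m≤n = small , large
  where
  some-left : Fin n
  some-left = fromℕ< (≤-trans 1≤k (≤-trans k≤m m≤n))
  some-right : Fin m
  some-right = fromℕ< (≤-trans 1≤k k≤m)

  small : 2 * k ≤ m → IsKTRDNumber (K n m) k (2 * k)
  small 2k≤m = K-has-kTRDS-of-size-2k k (≤-trans 2k≤m m≤n) 2k≤m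
             , K-kTRDS-size≥2k k some-left some-right

  large : m < 2 * k → IsKTRDNumber (K n m) k (n + m)
  large m<2k = K-has-kTRDS-of-size-n+m k (≤-trans k≤m m≤n) k≤m
             , K-kTRDS-size≥n+m k 1≤k m<2k
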